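{- Let $G$ be a connected threshold graph with minimum degree $\delta(G)\ge 3$. Then $px_3(G)\le 3$. Moreover, the bound is tight: there exist connected threshold graphs $G$ with $\delta(G)\ge3$ and $px_3(G)=3$.
   Context: All graphs are finite, simple and undirected. A graph $G$ is a threshold graph if there exist a weight function $w:V(G)\to\mathbb{R}$ and a real constant $t$ such that two distinct vertices $u,v$ are adjacent if and only if $w(u)+w(v)\ge t$. In an edge-colored graph (adjacent edges may receive the same color), a tree is proper if no two adjacent edges of it receive the same color. For a connected graph $G$ and $S\subseteq V(G)$, an $S$-tree is a tree in $G$ containing all vertices of $S$. An edge-coloring of $G$ is a $3$-proper coloring if for every $3$-subset $S$ of $V(G)$ there is a proper $S$-tree in $G$; $px_3(G)$ is the minimum number of colors in a $3$-proper coloring of $G$.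
   Formalization: The weight function w and the constant t defining a threshold graph take rational values instead of real ones. -}

module Defs where

open import Data.Nat using (ℕ; zero; suc; _≤_)
open import Data.Fin using (Fin; zero; suc; fromℕ; inject₁)
open import Data.Bool using (Bool; true; false; if_then_else_)
open import Data.List using (List; map; allFin)
open import Data.Nat.ListAction using (sum)
open import Data.Rational using (ℚ) renaming (_+_ to _+ℚ_; _≤_ to _≤ℚ_)
open import Data.Product using (Σ; ∃; _×_; _,_)
open import Relation.Binary.PropositionalEquality using (_≡_; _≢_)
open import Relation.Nullary using (¬_)
open import Function.Bundles using (_⇔_)
open import Function.Definitions using (Injective)

record Graph : Set where
  field
    n      : ℕ
    adj    : Fin n → Fin n → Bool
    sym    : ∀ u v → adj u v ≡ adj v u
    irrefl : ∀ u → adj u u ≡ false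

open Graph public

Adj : (G : Graph) → Fin (n G) → Fin (n G) → Set
Adj G u v = adj G u v ≡ true

data Walk {m : ℕ} (R : Fin m → Fin m → Set) : Fin m → Fin m → Set where
  here : ∀ {u} → Walk R u u
  step : ∀ {u v w} → R u v → Walk R v w → Walk R u w

Connected : Graph → Set
Connected G = ∀ u v → Walk (Adj G) u v

degree : (G : Graph) → Fin (n G) → ℕ
degree G v = sum (map (λ u → if adj G v u then 1 else 0) (allFin (n G)))

MinDegreeAtLeast : ℕ → Graph → Set
MinDegreeAtLeast d G = ∀ v → d ≤ degree G v

IsThreshold : Graph → Set
IsThreshold G =
  Σ (Fin (n G) → ℚ) λ w → Σ ℚ λ t →
    ∀ u v → u ≢ v → (Adj G u v ⇔ (t ≤ℚ (w u +ℚ w v)))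

record Subgraph (G : Graph) : Set where
  field
    vs      : Fin (n G) → Bool
    es      : Fin (n G) → Fin (n G) → Bool
    es-sym  : ∀ u v → es u v ≡ es v u
    es-adj  : ∀ u v → es u v ≡ true → Adj G u v
    es-vs   : ∀ u v → es u v ≡ true → vs u ≡ true

open Subgraph public

SEdge : {G : Graph} → Subgraph G → Fin (n G) → Fin (n G) → Set
SEdge H u v = es H u v ≡ true

HasCycle : {G : Graph} → Subgraph G → Set
HasCycle {G} H =
  Σ ℕ λ m → Σ (Fin (suc (suc (suc m))) → Fin (n G)) λ x →
    Injective _≡_ _≡_ x ×
    (∀ (i : Fin (suc (suc m))) → SEdge H (x (inject₁ i)) (x (suc i))) ×
    SEdge H (x (fromℕ (suc (suc m)))) (x zero)

IsTree : {G : Graph} → Subgraph G → Set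
IsTree {G} H =
  (∀ u v → vs H u ≡ true → vs H v ≡ true → Walk (SEdge H) u v) ×
  ¬ HasCycle H

-- Edge-colorings with k colors (a color for each unordered pair; only the
-- values on edges matter).
record EdgeColoring (G : Graph) (k : ℕ) : Set where
  field
    col     : Fin (n G) → Fin (n G) → Fin k
    col-sym : ∀ u v → col u v ≡ col v u

open EdgeColoring public

IsProper : {G : Graph} {k : ℕ} → EdgeColoring G k → Subgraph G → Set
IsProper c H =
  ∀ u v w → SEdge H u v → SEdge H u w → v ≢ w → col c u v ≢ col c u w

Is3Proper : {G : Graph} {k : ℕ} → EdgeColoring G k → Set
Is3Proper {G} c =
  ∀ x y z → x ≢ y → x ≢ z → y ≢ z →
    Σ (Subgraph G) λ H →
      IsTree H × vs H x ≡ true × vs H y ≡ true × vs H z ≡ true ×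
      IsProper c H

px3≤ : Graph → ℕ → Set
px3≤ G k = Σ (EdgeColoring G k) Is3Proper

px3≡ : Graph → ℕ → Set
px3≡ G zero    = px3≤ G zero
px3≡ G (suc k) = px3≤ G (suc k) × ¬ px3≤ G k

module Submission where

-- The vertices of a threshold graph are ordered by weight, and replacing a neighbour by a
-- heavier vertex keeps it a neighbour. When δ(G) ≥ 3, every vertex has a neighbour other
-- than the two heaviest vertices, hence one no heavier than the third heaviest; so the three
-- heaviest vertices are universal. Call them apexes 0, 1, 2 and colour an edge between two
-- apexes with the third index and an edge from any other vertex to apex i with i. For any
-- x, y, z the spider at apex 0 (apexes 1 and 2 below it, and x, y, z hanging from apexes
-- 0, 1, 2 respectively) is then a proper tree.
--
-- For tightness take the clique K₃ joined to 17 independent vertices. Given two colours,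
-- three independent vertices x, y, z see the clique in the same colours (17 > 2 · 8). In a
-- proper tree through them every vertex has degree at most 2, and no two of x, y, z can
-- share a neighbour, so x, y, z would be three leaves of a path.

open import Defs
open import Data.Product using (Σ; _×_; ∃; ∃-syntax; Σ-syntax; _,_; proj₁; proj₂; map₂)

open import Data.Bool as Bool using (Bool; true; false; if_then_else_; _∧_; _∨_; not)
open import Data.Bool.Properties using (∨-comm; ∧-zeroʳ; ∧-identityʳ)
open import Data.Empty using (⊥; ⊥-elim)
open import Data.Fin using (Fin; zero; suc; _≟_; fromℕ; splitAt; _↑ˡ_; _↑ʳ_; punchIn; punchOut)
open import Data.Fin.Properties as Fin using (any?; splitAt-↑ˡ; splitAt-↑ʳ; splitAt⁻¹-↑ˡ; splitAt⁻¹-↑ʳ)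
open import Data.List using (List; []; _∷_; length; tabulate; filter; allFin)
open import Data.List.Properties using (map-tabulate; length-tabulate)
open import Data.List.Membership.Propositional.Properties using (∈-allFin; ∈-filter⁺)
open import Data.List.Relation.Unary.All as All using (All; _∷_)
open import Data.List.Relation.Unary.AllPairs using (_∷_)
open import Data.List.Relation.Unary.All.Properties as All using (all-filter)
open import Data.List.Relation.Unary.Unique.Propositional using (Unique)
import Data.List.Relation.Unary.Unique.Propositional.Properties as Unique
open import Data.Nat using (ℕ; zero; suc; _+_; _≤_; _<_; z≤n; s≤s)
open import Data.Nat.ListAction using (sum)
open import Data.Nat.Properties as ℕ using ()
open import Algebra.Properties.CommutativeSemigroup ℕ.+-commutativeSemigroup using (interchange)
open import Data.Rational using (ℚ; 0ℚ; 1ℚ) renaming (_+_ to _+ℚ_; _≤_ to _≤ℚ_)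
open import Data.Rational.Properties as ℚ using ()
open import Data.Sum using (_⊎_; inj₁; inj₂; [_,_]; [_,_]′; swap)
open import Data.Maybe using (Maybe; just; nothing)
open import Data.Unit using (⊤; tt)
open import Level using (0ℓ)
open import Function.Base using (_∘_; case_of_)
open import Function.Bundles using (Equivalence; _⇔_; mk⇔)
open import Function.Definitions using (Injective)
open import Relation.Binary.PropositionalEquality as ≡ using (_≡_; _≢_; refl; cong; ≢-sym)
open import Relation.Nullary using (Dec; yes; no; does; ¬_; ¬?)
open import Relation.Nullary.Decidable using (_×-dec_; _⊎-dec_; _→-dec_; dec-true; dec-false; does-⇔; toWitness)
open import Relation.Unary using (Pred; Decidable)

open import Relation.Binary.Bundles using (DecTotalOrder)
import Data.List.Extrema (DecTotalOrder.totalOrder ℚ.≤-decTotalOrder) as Extrema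

private
  variable
    m : ℕ

_◅◅_ : {R : Fin m → Fin m → Set} {u v w : Fin m} → Walk R u v → Walk R v w → Walk R u w
here ◅◅ q = q
step e p ◅◅ q = step e (p ◅◅ q)

reverseWalk : {R : Fin m → Fin m → Set} → (∀ {u v} → R u v → R v u) →
              ∀ {u v} → Walk R u v → Walk R v u
reverseWalk R-sym here = here
reverseWalk R-sym (step e p) = reverseWalk R-sym p ◅◅ step (R-sym e) here

walk-preserves : {R : Fin m → Fin m → Set} (S : Fin m → Set) → (∀ {u v} → S u → R u v → S v) →
                 ∀ {u v} → Walk R u v → S u → S v
walk-preserves S closed here s = s
walk-preserves S closed (step e p) s = walk-preserves S closed p (closed s e)

injective⇒surjective : ∀ {f : Fin m → Fin m} → Injective _≡_ _≡_ f → ∀ i → ∃[ a ] f a ≡ i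
injective⇒surjective {suc m} {f} f-injective i with any? (λ a → f a ≟ i)
... | yes found = found
... | no missed = ⊥-elim (Fin.<⇒notInjective (ℕ.n<1+n m) squeezed-injective)
  where
  avoids : ∀ a → i ≢ f a
  avoids a e = missed (a , ≡.sym e)
  squeezed : Fin (suc m) → Fin m
  squeezed a = punchOut (avoids a)
  squeezed-injective : Injective _≡_ _≡_ squeezed
  squeezed-injective {a} {b} e = f-injective (Fin.punchOut-injective (avoids a) (avoids b) e)

first-step : ∀ {R : Fin m → Fin m → Set} {u v} → Walk R u v → u ≢ v → ∃[ q ] R u q
first-step here u≢v = ⊥-elim (u≢v refl)
first-step (step e _) _ = _ , e

triple : ∀ {A : Set} → A → A → A → Fin 3 → A
triple a b c zero = a
triple a b c (suc zero) = b
triple a b c (suc (suc zero)) = c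

distinct₃⇒injective : ∀ {A : Set} {a b c : A} → a ≢ b → a ≢ c → b ≢ c →
                      Injective _≡_ _≡_ (triple a b c)
distinct₃⇒injective a≢b a≢c b≢c {zero} {zero} _ = refl
distinct₃⇒injective a≢b a≢c b≢c {zero} {suc zero} e = ⊥-elim (a≢b e)
distinct₃⇒injective a≢b a≢c b≢c {zero} {suc (suc zero)} e = ⊥-elim (a≢c e)
distinct₃⇒injective a≢b a≢c b≢c {suc zero} {zero} e = ⊥-elim (a≢b (≡.sym e))
distinct₃⇒injective a≢b a≢c b≢c {suc zero} {suc zero} _ = refl
distinct₃⇒injective a≢b a≢c b≢c {suc zero} {suc (suc zero)} e = ⊥-elim (b≢c e)
distinct₃⇒injective a≢b a≢c b≢c {suc (suc zero)} {zero} e = ⊥-elim (a≢c (≡.sym e))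
distinct₃⇒injective a≢b a≢c b≢c {suc (suc zero)} {suc zero} e = ⊥-elim (b≢c (≡.sym e))
distinct₃⇒injective a≢b a≢c b≢c {suc (suc zero)} {suc (suc zero)} _ = refl

witness : ∀ {a} {A : Set a} (a? : Dec A) → does a? ≡ true → A
witness (yes a) _ = a

≡does⇒⇔ : ∀ {a} {A : Set a} {b} (a? : Dec A) → b ≡ does a? → (b ≡ true ⇔ A)
≡does⇒⇔ a? b≡does = mk⇔ (λ b≡true → witness a? (≡.trans (≡.sym b≡does) b≡true))
                         (λ a → ≡.trans b≡does (dec-true a? a))

module _ {G : Graph} where

  Adj-sym : ∀ {u v} → Adj G u v → Adj G v u
  Adj-sym {u} {v} e = ≡.trans (sym G v u) e

  Adj⇒≢ : ∀ {u v} → Adj G u v → u ≢ v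
  Adj⇒≢ {u} e refl with ≡.trans (≡.sym (irrefl G u)) e
  ... | ()

indicator : Fin m → Fin m → ℕ
indicator p i = if does (i ≟ p) then 1 else 0

sum-tabulate-mono : (f g : Fin m → ℕ) → (∀ i → f i ≤ g i) → sum (tabulate f) ≤ sum (tabulate g)
sum-tabulate-mono {zero} f g f≤g = z≤n
sum-tabulate-mono {suc m} f g f≤g =
  ℕ.+-mono-≤ (f≤g zero) (sum-tabulate-mono (λ i → f (suc i)) (λ i → g (suc i)) (λ i → f≤g (suc i)))

sum-tabulate-+ : (f g : Fin m → ℕ) →
                 sum (tabulate (λ i → f i + g i)) ≡ sum (tabulate f) + sum (tabulate g)
sum-tabulate-+ {zero} f g = refl
sum-tabulate-+ {suc m} f g =
  ≡.trans (cong (f zero + g zero +_) (sum-tabulate-+ (λ i → f (suc i)) (λ i → g (suc i))))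
          (interchange (f zero) (g zero) _ _)

sum-tabulate-0 : ∀ m → sum (tabulate {n = m} (λ _ → 0)) ≡ 0
sum-tabulate-0 zero = refl
sum-tabulate-0 (suc m) = sum-tabulate-0 m

sum-tabulate-indicator : (p : Fin m) → sum (tabulate (indicator p)) ≡ 1
sum-tabulate-indicator {suc m} zero = cong suc (sum-tabulate-0 m)
sum-tabulate-indicator {suc m} (suc p) = sum-tabulate-indicator p

module _ (G : Graph) where

  degree≤2 : ∀ {u} p q → (∀ v → Adj G u v → v ≡ p ⊎ v ≡ q) → degree G u ≤ 2
  degree≤2 {u} p q nbrs = begin
    degree G u                                                  ≡⟨ cong sum (map-tabulate (λ v → v) χ) ⟩
    sum (tabulate χ)                                            ≤⟨ sum-tabulate-mono χ _ χ≤p+q ⟩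
    sum (tabulate (λ v → indicator p v + indicator q v))        ≡⟨ sum-tabulate-+ (indicator p) (indicator q) ⟩
    sum (tabulate (indicator p)) + sum (tabulate (indicator q)) ≡⟨ ≡.cong₂ _+_ (sum-tabulate-indicator p)
                                                                                (sum-tabulate-indicator q) ⟩
    2                                                           ∎
    where
    open ℕ.≤-Reasoning
    χ : Fin (n G) → ℕ
    χ v = if adj G u v then 1 else 0
    χ≤p+q : ∀ v → χ v ≤ indicator p v + indicator q v
    χ≤p+q v with adj G u v in e | v ≟ p | v ≟ q
    ... | false | _ | _ = z≤n
    ... | true | yes _ | _ = s≤s z≤n
    ... | true | no _ | yes _ = s≤s z≤n
    ... | true | no v≢p | no v≢q = ⊥-elim ([ v≢p , v≢q ] (nbrs v e))

  neighbour-avoiding : ∀ {u} → 3 ≤ degree G u → ∀ p q → ∃[ v ] Adj G u v × v ≢ p × v ≢ q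
  neighbour-avoiding {u} deg≥3 p q
    with any? (λ v → (adj G u v Bool.≟ true) ×-dec ¬? (v ≟ p) ×-dec ¬? (v ≟ q))
  ... | yes found = found
  ... | no none = ⊥-elim (ℕ.≤⇒≯ (degree≤2 p q nbrs) deg≥3)
    where
    nbrs : ∀ v → Adj G u v → v ≡ p ⊎ v ≡ q
    nbrs v e with v ≟ p | v ≟ q
    ... | yes v≡p | _ = inj₁ v≡p
    ... | no _ | yes v≡q = inj₂ v≡q
    ... | no v≢p | no v≢q = ⊥-elim (none (v , e , v≢p , v≢q))

-- The three heaviest vertices of a threshold graph

record Heaviest (w : Fin m → ℚ) (P : Pred (Fin m) 0ℓ) : Set where
  field
    vertex : Fin m
    satisfies : P vertex
    maximal : ∀ v → P v → w v ≤ℚ w vertex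

heaviest : (w : Fin m → ℚ) {P : Pred (Fin m) 0ℓ} → Decidable P → ∃ P → Heaviest w P
heaviest {m} w P? (v₀ , Pv₀) = record
  { vertex = Extrema.argmax w v₀ candidates
  ; satisfies = Extrema.argmax-all w Pv₀ (all-filter P? (allFin m))
  ; maximal = λ v Pv → All.lookup (Extrema.f[xs]≤f[argmax] {f = w} v₀ candidates)
                                  (∈-filter⁺ P? (∈-allFin v) Pv)
  }
  where
  candidates : List (Fin m)
  candidates = filter P? (allFin m)

Universal : (G : Graph) → Fin (n G) → Set
Universal G u = ∀ v → u ≢ v → Adj G u v

record UniversalTriple (G : Graph) : Set where
  field
    apex : Fin 3 → Fin (n G)
    apex-injective : Injective _≡_ _≡_ apex
    apex-universal : ∀ i → Universal G (apex i)

module ThresholdGraph (G : Graph) (w : Fin (n G) → ℚ) (t : ℚ)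
  (threshold : ∀ u v → u ≢ v → (Adj G u v ⇔ t ≤ℚ (w u +ℚ w v))) where

  adj-heavier : ∀ {u v q} → Adj G u v → w v ≤ℚ w q → u ≢ q → Adj G u q
  adj-heavier {u} {v} {q} u~v v≤q u≢q = Equivalence.from (threshold u q u≢q)
    (ℚ.≤-trans (Equivalence.to (threshold u v (Adj⇒≢ {G} u~v)) u~v) (ℚ.+-monoʳ-≤ (w u) v≤q))

  universal-above : ∀ {q p} → (∀ u → ∃[ v ] Adj G u v × w v ≤ℚ w q) → w q ≤ℚ w p → Universal G p
  universal-above {q} {p} light q≤p u p≢u with light u
  ... | v , u~v , v≤q = Adj-sym {G} (adj-heavier u~v (ℚ.≤-trans v≤q q≤p) (≢-sym p≢u))

threshold⇒universal-triple : (G : Graph) → IsThreshold G → MinDegreeAtLeast 3 G → Fin (n G) →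
                             UniversalTriple G
threshold⇒universal-triple G (w , t , threshold) deg≥3 v₀ = record
  { apex = triple a b c
  ; apex-injective = distinct₃⇒injective (≢-sym B.satisfies) (≢-sym (proj₁ C.satisfies))
                                         (≢-sym (proj₂ C.satisfies))
  ; apex-universal = universal
  }
  where
  open ThresholdGraph G w t threshold
  heaviest₁ : Heaviest w (λ _ → ⊤)
  heaviest₁ = heaviest w (λ _ → yes tt) (v₀ , tt)
  module A = Heaviest heaviest₁
  a : Fin (n G)
  a = A.vertex
  heaviest₂ : Heaviest w (_≢ a)
  heaviest₂ = heaviest w (λ v → ¬? (v ≟ a))
                       (map₂ (proj₁ ∘ proj₂) (neighbour-avoiding G (deg≥3 a) a a))
  module B = Heaviest heaviest₂
  b : Fin (n G)
  b = B.vertex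
  heaviest₃ : Heaviest w (λ v → v ≢ a × v ≢ b)
  heaviest₃ = heaviest w (λ v → ¬? (v ≟ a) ×-dec ¬? (v ≟ b))
                       (map₂ proj₂ (neighbour-avoiding G (deg≥3 a) a b))
  module C = Heaviest heaviest₃
  c : Fin (n G)
  c = C.vertex
  light : ∀ u → ∃[ v ] Adj G u v × w v ≤ℚ w c
  light u = let v , u~v , v≢a , v≢b = neighbour-avoiding G (deg≥3 u) a b
            in v , u~v , C.maximal v (v≢a , v≢b)
  universal : ∀ i → Universal G (triple a b c i)
  universal zero = universal-above light (A.maximal c tt)
  universal (suc zero) = universal-above light (B.maximal c (proj₁ C.satisfies))
  universal (suc (suc zero)) = universal-above light ℚ.≤-refl

-- Trees of height two given by parent pointers

module ParentTree (G : Graph) (root : Fin (n G)) (member : Fin (n G) → Bool)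
  (parent : Fin (n G) → Fin (n G)) (height : Fin (n G) → ℕ)
  (parent-member : ∀ {v} → member v ≡ true → v ≢ root → member (parent v) ≡ true)
  (parent-adj : ∀ {v} → member v ≡ true → v ≢ root → Adj G v (parent v))
  (parent-lower : ∀ {v} → member v ≡ true → v ≢ root → height (parent v) < height v)
  (height≤2 : ∀ v → height v ≤ 2)
  where

  ChildOf : Fin (n G) → Fin (n G) → Set
  ChildOf v u = member v ≡ true × v ≢ root × parent v ≡ u

  Link : Fin (n G) → Fin (n G) → Set
  Link u v = ChildOf u v ⊎ ChildOf v u

  link? : ∀ u v → Dec (Link u v)
  link? u v = child? u v ⊎-dec child? v u
    where
    child? : ∀ v u → Dec (ChildOf v u)
    child? v u = (member v Bool.≟ true) ×-dec ¬? (v ≟ root) ×-dec (parent v ≟ u)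

  link-adj : ∀ {u v} → Link u v → Adj G u v
  link-adj (inj₁ (mu , u≢root , refl)) = parent-adj mu u≢root
  link-adj (inj₂ (mv , v≢root , refl)) = Adj-sym {G} (parent-adj mv v≢root)

  link-member : ∀ {u v} → Link u v → member u ≡ true
  link-member (inj₁ (mu , _ , _)) = mu
  link-member (inj₂ (mv , v≢root , refl)) = parent-member mv v≢root

  tree : Subgraph G
  tree = record
    { vs = member
    ; es = λ u v → does (link? u v)
    ; es-sym = λ u v → does-⇔ (mk⇔ swap swap) (link? u v) (link? v u)
    ; es-adj = λ u v e → link-adj (witness (link? u v) e)
    ; es-vs = λ u v e → link-member (witness (link? u v) e)
    }

  Edge : Fin (n G) → Fin (n G) → Set
  Edge = SEdge tree

  edge-sym : ∀ {u v} → Edge u v → Edge v u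
  edge-sym {u} {v} e = ≡.trans (es-sym tree v u) e

  link : ∀ {u v} → Edge u v → Link u v
  link {u} {v} = witness (link? u v)

  parent-edge : ∀ {v} → member v ≡ true → v ≢ root → Edge v (parent v)
  parent-edge {v} mv v≢root = dec-true (link? v (parent v)) (inj₁ (mv , v≢root , refl))

  link-height : ∀ {u v} → Link u v → height u < height v ⊎ height v < height u
  link-height (inj₁ (mu , u≢root , refl)) = inj₂ (parent-lower mu u≢root)
  link-height (inj₂ (mv , v≢root , refl)) = inj₁ (parent-lower mv v≢root)

  -- Every vertex has a single parent, so a walk that moves away from the root cannot turn back.
  keeps-descending : ∀ {u v w} → Link u v → height u < height v → Link v w → w ≢ u → height v < height w
  keeps-descending (inj₁ (mu , u≢root , refl)) hu<hv _ _ = ⊥-elim (ℕ.<-asym hu<hv (parent-lower mu u≢root))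
  keeps-descending (inj₂ (_ , _ , refl)) _ (inj₁ (_ , _ , refl)) w≢u = ⊥-elim (w≢u refl)
  keeps-descending (inj₂ _) _ (inj₂ (mw , w≢root , refl)) _ = parent-lower mw w≢root

  no-three-descents : ∀ {u₀ u₁ u₂ u₃} → Link u₀ u₁ → height u₀ < height u₁ →
                      Link u₁ u₂ → u₂ ≢ u₀ → Link u₂ u₃ → u₃ ≢ u₁ → ⊥
  no-three-descents {u₀} {u₁} {u₂} {u₃} l₀₁ h₀₁ l₁₂ u₂≢u₀ l₂₃ u₃≢u₁ =
    ℕ.<⇒≱ 2<h₃ (height≤2 u₃)
    where
    h₁₂ : height u₁ < height u₂
    h₁₂ = keeps-descending l₀₁ h₀₁ l₁₂ u₂≢u₀
    h₂₃ : height u₂ < height u₃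
    h₂₃ = keeps-descending l₁₂ h₁₂ l₂₃ u₃≢u₁
    2<h₃ : 2 < height u₃
    2<h₃ = ℕ.≤-trans (s≤s (ℕ.≤-trans (s≤s (ℕ.≤-trans (s≤s z≤n) h₀₁)) h₁₂)) h₂₃

  acyclic : ¬ HasCycle tree
  acyclic (k , x , x-injective , path , close) with link-height (link (path zero))
  acyclic (zero , x , x-injective , path , close) | inj₁ h₀<h₁ =
    no-three-descents (link (path zero)) h₀<h₁
                      (link (path (suc zero))) (λ e → case x-injective e of λ ())
                      (link close) (λ e → case x-injective e of λ ())
  acyclic (suc k , x , x-injective , path , close) | inj₁ h₀<h₁ =
    no-three-descents (link (path zero)) h₀<h₁
                      (link (path (suc zero))) (λ e → case x-injective e of λ ())
                      (link (path (suc (suc zero)))) (λ e → case x-injective e of λ ())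
  acyclic (k , x , x-injective , path , close) | inj₂ h₁<h₀ =
    no-three-descents (link (edge-sym (path zero))) h₁<h₀
                      (link (edge-sym close)) (λ e → case x-injective e of λ ())
                      (link (edge-sym (path (fromℕ (suc k))))) (λ e → case x-injective e of λ ())

  to-root : ∀ h {v} → height v ≤ h → member v ≡ true → Walk Edge v root
  to-root h {v} hv≤h mv with v ≟ root
  ... | yes refl = here
  to-root zero {v} hv≤h mv | no v≢root with ℕ.≤-trans (parent-lower mv v≢root) hv≤h
  ... | ()
  to-root (suc h) {v} hv≤h mv | no v≢root =
    step (parent-edge mv v≢root)
         (to-root h (ℕ.≤-pred (ℕ.≤-trans (parent-lower mv v≢root) hv≤h)) (parent-member mv v≢root))

  is-tree : IsTree tree
  is-tree = connected , acyclic
    where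
    connected : ∀ u v → member u ≡ true → member v ≡ true → Walk Edge u v
    connected u v mu mv = to-root 2 (height≤2 u) mu ◅◅ reverseWalk edge-sym (to-root 2 (height≤2 v) mv)

  proper : ∀ {k} (c : EdgeColoring G k) →
           (∀ {v w u} → ChildOf v u → ChildOf w u → v ≢ w → col c v u ≢ col c w u) →
           (∀ {v u p} → ChildOf v u → ChildOf u p → col c v u ≢ col c u p) →
           IsProper c tree
  proper c siblings grandchild u v w e₁ e₂ v≢w with link e₁ | link e₂
  ... | inj₁ (_ , _ , refl) | inj₁ (_ , _ , refl) = ⊥-elim (v≢w refl)
  ... | inj₁ u→v | inj₂ w→u = λ same → grandchild w→u u→v (≡.trans (col-sym c w u) (≡.sym same))
  ... | inj₂ v→u | inj₁ u→w = λ same → grandchild v→u u→w (≡.trans (col-sym c v u) same)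
  ... | inj₂ v→u | inj₂ w→u =
    λ same → siblings v→u w→u v≢w (≡.trans (col-sym c v u) (≡.trans same (col-sym c u w)))

-- Three universal vertices suffice

px3≤-empty : ∀ {G k} → ¬ Fin (n G) → px3≤ G k
px3≤-empty empty = record { col = λ u _ → ⊥-elim (empty u) ; col-sym = λ u _ → ⊥-elim (empty u) }
                 , λ x _ _ _ _ _ → ⊥-elim (empty x)

-- For i ≢ j, third i j is the remaining index; its value on the diagonal is irrelevant.
third : Fin 3 → Fin 3 → Fin 3
third zero (suc zero) = suc (suc zero)
third (suc zero) zero = suc (suc zero)
third zero (suc (suc zero)) = suc zero
third (suc (suc zero)) zero = suc zero
third _ _ = zero

third-comm : ∀ i j → third i j ≡ third j i
third-comm = toWitness {a? = Fin.all? λ i → Fin.all? λ j → third i j ≟ third j i} tt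

third-fresh : ∀ i → i ≢ zero → third i zero ≢ i × third i zero ≢ zero
third-fresh = toWitness {a? = Fin.all? λ i →
  ¬? (i ≟ zero) →-dec (¬? (third i zero ≟ i) ×-dec ¬? (third i zero ≟ zero))} tt

third-injective : ∀ i j → i ≢ zero → j ≢ zero → third i zero ≡ third j zero → i ≡ j
third-injective = toWitness {a? = Fin.all? λ i → Fin.all? λ j →
  ¬? (i ≟ zero) →-dec ¬? (j ≟ zero) →-dec (third i zero ≟ third j zero) →-dec (i ≟ j)} tt

tone : Maybe (Fin 3) → Maybe (Fin 3) → Fin 3
tone (just i) (just j) = third i j
tone (just i) nothing = i
tone nothing (just j) = j
tone nothing nothing = zero

tone-comm : ∀ p q → tone p q ≡ tone q p
tone-comm (just i) (just j) = third-comm i j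
tone-comm (just i) nothing = refl
tone-comm nothing (just j) = refl
tone-comm nothing nothing = refl

module UniversalTriplePx3 (G : Graph) (U : UniversalTriple G) where
  open UniversalTriple U

  V : Set
  V = Fin (n G)

  NotApex : V → Set
  NotApex v = ∀ i → apex i ≢ v

  apex? : ∀ v → Dec (∃[ i ] apex i ≡ v)
  apex? v = any? (λ i → apex i ≟ v)

  kind : V → Maybe (Fin 3)
  kind v with apex? v
  ... | yes (i , _) = just i
  ... | no _ = nothing

  kind-apex : ∀ i → kind (apex i) ≡ just i
  kind-apex i with apex? (apex i)
  ... | yes (j , e) = cong just (apex-injective e)
  ... | no none = ⊥-elim (none (i , refl))

  kind-other : ∀ {v} → NotApex v → kind v ≡ nothing
  kind-other {v} not-apex with apex? v
  ... | yes (j , e) = ⊥-elim (not-apex j e)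
  ... | no _ = refl

  colouring : EdgeColoring G 3
  colouring = record { col = λ u v → tone (kind u) (kind v) ; col-sym = λ u v → tone-comm (kind u) (kind v) }

  col-apex-apex : ∀ i j → col colouring (apex i) (apex j) ≡ third i j
  col-apex-apex i j = ≡.cong₂ tone (kind-apex i) (kind-apex j)

  col-other-apex : ∀ {v} → NotApex v → ∀ j → col colouring v (apex j) ≡ j
  col-other-apex not-apex j = ≡.cong₂ tone (kind-other not-apex) (kind-apex j)

  module Spider (x y z : V) where

    terminal : Fin 3 → V
    terminal = triple x y z

    Root : V
    Root = apex zero

    data Role (v : V) : Set where
      hub : ∀ i → apex i ≡ v → Role v
      pendant : ∀ i → NotApex v → terminal i ≡ v → Role v
      absent : NotApex v → (∀ i → terminal i ≢ v) → Role v

    role : ∀ v → Role v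
    role v with apex? v | any? (λ i → terminal i ≟ v)
    ... | yes (i , e) | _ = hub i e
    ... | no not-apex | yes (i , e) = pendant i (λ j e′ → not-apex (j , e′)) e
    ... | no not-apex | no absent′ = absent (λ j e′ → not-apex (j , e′)) (λ i e′ → absent′ (i , e′))

    member : V → Bool
    member v with role v
    ... | absent _ _ = false
    ... | _ = true

    parent : V → V
    parent v with role v
    ... | pendant i _ _ = apex i
    ... | _ = apex zero

    height : V → ℕ
    height v with role v
    ... | hub zero _ = 0
    ... | hub (suc _) _ = 1
    ... | pendant _ _ _ = 2
    ... | absent _ _ = 0

    member-apex : ∀ i → member (apex i) ≡ true
    member-apex i with role (apex i)
    ... | hub _ _ = refl
    ... | pendant _ not-apex _ = ⊥-elim (not-apex i refl)
    ... | absent not-apex _ = ⊥-elim (not-apex i refl)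

    member-terminal : ∀ i → member (terminal i) ≡ true
    member-terminal i with role (terminal i)
    ... | hub _ _ = refl
    ... | pendant _ _ _ = refl
    ... | absent _ elsewhere = ⊥-elim (elsewhere i refl)

    parent-apex : ∀ i → parent (apex i) ≡ apex zero
    parent-apex i with role (apex i)
    ... | hub _ _ = refl
    ... | pendant _ not-apex _ = ⊥-elim (not-apex i refl)
    ... | absent not-apex _ = ⊥-elim (not-apex i refl)

    height-root : height (apex zero) ≡ 0
    height-root with role (apex zero)
    ... | hub zero _ = refl
    ... | hub (suc _) e = case apex-injective e of λ ()
    ... | pendant _ not-apex _ = ⊥-elim (not-apex zero refl)
    ... | absent not-apex _ = ⊥-elim (not-apex zero refl)

    height-apex : ∀ i → height (apex i) ≤ 1
    height-apex i with role (apex i)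
    ... | hub zero _ = z≤n
    ... | hub (suc _) _ = s≤s z≤n
    ... | pendant _ not-apex _ = ⊥-elim (not-apex i refl)
    ... | absent not-apex _ = ⊥-elim (not-apex i refl)

    parent-member : ∀ {v} → member v ≡ true → v ≢ Root → member (parent v) ≡ true
    parent-member {v} _ _ with role v
    ... | hub _ _ = member-apex zero
    ... | pendant i _ _ = member-apex i
    ... | absent _ _ = member-apex zero

    parent-adj : ∀ {v} → member v ≡ true → v ≢ Root → Adj G v (parent v)
    parent-adj {v} mv v≢root with role v
    ... | hub _ refl = Adj-sym {G} (apex-universal zero _ (λ e → v≢root (≡.sym e)))
    ... | pendant i not-apex _ = Adj-sym {G} (apex-universal i v (not-apex i))
    ... | absent _ _ = case mv of λ ()

    parent-lower : ∀ {v} → member v ≡ true → v ≢ Root → height (parent v) < height v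
    parent-lower {v} mv v≢root with role v
    ... | hub zero e = ⊥-elim (v≢root (≡.sym e))
    ... | hub (suc _) _ = ℕ.≤-reflexive (cong suc height-root)
    ... | pendant i _ _ = s≤s (height-apex i)
    ... | absent _ _ = case mv of λ ()

    height≤2 : ∀ v → height v ≤ 2
    height≤2 v with role v
    ... | hub zero _ = z≤n
    ... | hub (suc _) _ = s≤s z≤n
    ... | pendant _ _ _ = ℕ.≤-refl
    ... | absent _ _ = z≤n

    open ParentTree G Root member parent height parent-member parent-adj parent-lower height≤2 public

    apex-≢-root : ∀ {i} → apex i ≢ Root → i ≢ zero
    apex-≢-root apex≢root refl = apex≢root refl

    apexes-apart : ∀ {i j} → i ≢ zero → j ≢ zero → i ≢ j →
                   col colouring (apex i) Root ≢ col colouring (apex j) Root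
    apexes-apart {i} {j} i≢0 j≢0 i≢j same = i≢j (third-injective i j i≢0 j≢0 (begin
      third i zero                ≡⟨ col-apex-apex i zero ⟨
      col colouring (apex i) Root ≡⟨ same ⟩
      col colouring (apex j) Root ≡⟨ col-apex-apex j zero ⟩
      third j zero                ∎))
      where open ≡.≡-Reasoning

    apex-pendant-apart : ∀ {i v} → i ≢ zero → NotApex v → col colouring (apex i) Root ≢ col colouring v Root
    apex-pendant-apart {i} {v} i≢0 not-apex same = proj₂ (third-fresh i i≢0) (begin
      third i zero                ≡⟨ col-apex-apex i zero ⟨
      col colouring (apex i) Root ≡⟨ same ⟩
      col colouring v Root        ≡⟨ col-other-apex not-apex zero ⟩
      zero                        ∎)
      where open ≡.≡-Reasoning

    siblings : ∀ {v w u} → ChildOf v u → ChildOf w u → v ≢ w → col colouring v u ≢ col colouring w u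
    siblings {v} {w} (mv , v≢root , refl) (mw , w≢root , pw) v≢w with role v | role w
    ... | hub i refl | hub j refl =
          apexes-apart (apex-≢-root v≢root) (apex-≢-root w≢root) (λ i≡j → v≢w (cong apex i≡j))
    ... | hub i refl | pendant _ not-apex _ = apex-pendant-apart (apex-≢-root v≢root) not-apex
    ... | pendant _ not-apex _ | hub j refl = ≡.subst (λ u → col colouring v u ≢ col colouring (apex j) u) pw
          (≢-sym (apex-pendant-apart (apex-≢-root w≢root) not-apex))
    ... | pendant i _ refl | pendant j _ refl = λ _ → v≢w (cong terminal (apex-injective (≡.sym pw)))
    ... | absent _ _ | _ = case mv of λ ()
    ... | _ | absent _ _ = case mw of λ ()

    grandchild : ∀ {v u p} → ChildOf v u → ChildOf u p → col colouring v u ≢ col colouring u p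
    grandchild {v} {_} {p} (mv , _ , refl) (_ , u≢root , pu≡p) with role v
    ... | hub _ _ = ⊥-elim (u≢root refl)
    ... | pendant i not-apex _ = λ same → proj₁ (third-fresh i (apex-≢-root u≢root)) (begin
          third i zero                ≡⟨ col-apex-apex i zero ⟨
          col colouring (apex i) Root ≡⟨ cong (col colouring (apex i))
                                              (≡.trans (≡.sym (parent-apex i)) pu≡p) ⟩
          col colouring (apex i) p    ≡⟨ same ⟨
          col colouring v (apex i)    ≡⟨ col-other-apex not-apex i ⟩
          i                           ∎)
      where
      open ≡.≡-Reasoning
    ... | absent _ _ = case mv of λ ()

  universal-triple⇒px3≤3 : px3≤ G 3
  universal-triple⇒px3≤3 = colouring , λ x y z _ _ _ → let open Spider x y z in
    tree , is-tree , member-terminal zero , member-terminal (suc zero) , member-terminal (suc (suc zero)) ,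
    proper colouring siblings grandchild

threshold-px3≤3 : (G : Graph) → IsThreshold G → MinDegreeAtLeast 3 G → px3≤ G 3
threshold-px3≤3 G threshold deg≥3 with any? {n = n G} (λ _ → yes tt)
... | yes (v , _) = UniversalTriplePx3.universal-triple⇒px3≤3 G (threshold⇒universal-triple G threshold deg≥3 v)
... | no empty = px3≤-empty (λ v → empty (v , tt))

module _ {G : Graph} {k : ℕ} {c : EdgeColoring G k} {H : Subgraph G} (proper : IsProper c H) where

  proper-apart : ∀ {q u v} → SEdge H q u → SEdge H q v → u ≢ v → col c u q ≢ col c v q
  proper-apart {q} {u} {v} e₁ e₂ u≢v same =
    proper q u v e₁ e₂ u≢v (≡.trans (col-sym c q u) (≡.trans same (col-sym c v q)))

  proper-degree≤ : ∀ {u} (nbr : Fin (suc k) → Fin (n G)) → Injective _≡_ _≡_ nbr →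
                   ¬ (∀ i → SEdge H u (nbr i))
  proper-degree≤ {u} nbr nbr-injective adjacent with Fin.pigeonhole (ℕ.n<1+n k) (λ i → col c u (nbr i))
  ... | i , j , i<j , same = proper u _ _ (adjacent i) (adjacent j) (Fin.<⇒≢ i<j ∘ nbr-injective) same

proper₂-max-degree-2 : ∀ {G} {c : EdgeColoring G 2} {H : Subgraph G} → IsProper c H →
                       ∀ {u v₁ v₂ w} → SEdge H u v₁ → SEdge H u v₂ → v₁ ≢ v₂ →
                       SEdge H u w → w ≡ v₁ ⊎ w ≡ v₂
proper₂-max-degree-2 {c = c} {H = H} proper {u} {v₁} {v₂} {w} e₁ e₂ v₁≢v₂ e with w ≟ v₁ | w ≟ v₂
... | yes w≡v₁ | _ = inj₁ w≡v₁
... | no _ | yes w≡v₂ = inj₂ w≡v₂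
... | no w≢v₁ | no w≢v₂ = ⊥-elim (proper-degree≤ {c = c} {H = H} proper (triple v₁ v₂ w)
        (distinct₃⇒injective v₁≢v₂ (w≢v₁ ∘ ≡.sym) (w≢v₂ ∘ ≡.sym)) adjacent)
  where
  adjacent : ∀ i → SEdge H u ((triple v₁ v₂ w) i)
  adjacent zero = e₁
  adjacent (suc zero) = e₂
  adjacent (suc (suc zero)) = e

module MaxDegreeTwo (E : Fin m → Fin m → Set) (E-sym : ∀ {u v} → E u v → E v u)
  (max-degree-2 : ∀ {u v₁ v₂ w} → E u v₁ → E u v₂ → v₁ ≢ v₂ → E u w → w ≡ v₁ ⊎ w ≡ v₂) where

  Leaf : Fin m → Set
  Leaf u = ∀ {w w′} → E u w → E u w′ → w ≡ w′

  -- A path that enters v from p, never steps back, and stops at a leaf.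
  data PathToLeaf (p v : Fin m) : Set where
    end : (∀ {w} → E v w → w ≡ p) → PathToLeaf p v
    next : ∀ {w} → E v w → w ≢ p → PathToLeaf v w → PathToLeaf p v

  On : ∀ {p v} → PathToLeaf p v → Fin m → Set
  On {v = v} (end _) u = u ≡ v
  On {v = v} (next _ _ path) u = u ≡ v ⊎ On path u

  terminus : ∀ {p v} → PathToLeaf p v → Fin m
  terminus {v = v} (end _) = v
  terminus (next _ _ path) = terminus path

  on-start : ∀ {p v} (path : PathToLeaf p v) → On path v
  on-start (end _) = refl
  on-start (next _ _ _) = inj₁ refl

  on-closed : ∀ {p v u w} → E p v → (path : PathToLeaf p v) → On path u → E u w → w ≡ p ⊎ On path w
  on-closed _ (end only-p) refl e = inj₁ (only-p e)
  on-closed p~v (next v~w w≢p path) (inj₁ refl) e with max-degree-2 (E-sym p~v) v~w (w≢p ∘ ≡.sym) e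
  ... | inj₁ w≡p = inj₁ w≡p
  ... | inj₂ refl = inj₂ (inj₂ (on-start path))
  on-closed _ (next v~w _ path) (inj₂ on) e with on-closed v~w path on e
  ... | inj₁ refl = inj₂ (inj₁ refl)
  ... | inj₂ on′ = inj₂ (inj₂ on′)

  leaf-is-terminus : ∀ {p v u} → E p v → (path : PathToLeaf p v) → On path u → Leaf u → u ≡ terminus path
  leaf-is-terminus _ (end _) refl _ = refl
  leaf-is-terminus p~v (next v~w w≢p _) (inj₁ refl) leaf = ⊥-elim (w≢p (leaf v~w (E-sym p~v)))
  leaf-is-terminus _ (next v~w _ path) (inj₂ on) leaf = leaf-is-terminus v~w path on leaf

  reachable-on-path : ∀ {x v y} → E x v → Leaf x → (path : PathToLeaf x v) →
                      Walk E x y → y ≡ x ⊎ On path y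
  reachable-on-path {x} {v} x~v leaf path walk = walk-preserves S closed walk (inj₁ refl)
    where
    S : Fin m → Set
    S u = u ≡ x ⊎ On path u
    closed : ∀ {u w} → S u → E u w → S w
    closed (inj₁ refl) e = inj₂ (≡.subst (On path) (leaf x~v e) (on-start path))
    closed (inj₂ on) e = on-closed x~v path on e

  at-most-two-leaves : ∀ {x v y z} → E x v → Leaf x → PathToLeaf x v → Walk E x y → Walk E x z →
                       Leaf y → Leaf z → y ≢ x → z ≢ x → y ≡ z
  at-most-two-leaves x~v leaf-x path x⇝y x⇝z leaf-y leaf-z y≢x z≢x =
    ≡.trans (at-terminus x⇝y leaf-y y≢x) (≡.sym (at-terminus x⇝z leaf-z z≢x))
    where
    at-terminus : ∀ {u} → Walk E _ u → Leaf u → u ≢ _ → u ≡ terminus path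
    at-terminus x⇝u leaf-u u≢x with reachable-on-path x~v leaf-x path x⇝u
    ... | inj₁ u≡x = ⊥-elim (u≢x u≡x)
    ... | inj₂ on = leaf-is-terminus x~v path on leaf-u

-- Complete split graphs

inClique : ∀ ω {k} → Fin (ω + k) → Bool
inClique ω v = [ (λ _ → true) , (λ _ → false) ]′ (splitAt ω v)

splitAdj : ∀ ω {k} → Fin (ω + k) → Fin (ω + k) → Bool
splitAdj ω u v = (inClique ω u ∨ inClique ω v) ∧ not (does (u ≟ v))

completeSplit : ℕ → ℕ → Graph
completeSplit ω k = record
  { n = ω + k
  ; adj = splitAdj ω
  ; sym = λ u v → ≡.cong₂ _∧_ (∨-comm (inClique ω u) (inClique ω v))
                              (cong not (does-⇔ (mk⇔ ≡.sym ≡.sym) (u ≟ v) (v ≟ u)))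
  ; irrefl = λ u → ≡.trans (cong (λ b → (inClique ω u ∨ inClique ω u) ∧ not b) (dec-true (u ≟ u) refl))
                          (∧-zeroʳ _)
  }

module _ {ω k : ℕ} where

  clique : Fin ω → Fin (ω + k)
  clique i = i ↑ˡ k

  coclique : Fin k → Fin (ω + k)
  coclique j = ω ↑ʳ j

  splitAdj-≢ : ∀ {u v : Fin (ω + k)} → u ≢ v → splitAdj ω u v ≡ inClique ω u ∨ inClique ω v
  splitAdj-≢ {u} {v} u≢v =
    ≡.trans (cong (λ b → (inClique ω u ∨ inClique ω v) ∧ not b) (dec-false (u ≟ v) u≢v))
            (∧-identityʳ _)

  clique-or-coclique : ∀ v → (∃[ i ] v ≡ clique i) ⊎ (∃[ j ] v ≡ coclique j)
  clique-or-coclique v with splitAt ω v in eq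
  ... | inj₁ i = inj₁ (i , ≡.sym (splitAt⁻¹-↑ˡ eq))
  ... | inj₂ j = inj₂ (j , ≡.sym (splitAt⁻¹-↑ʳ eq))

  clique≢coclique : ∀ {i j} → clique i ≢ coclique j
  clique≢coclique {i} {j} e
    with ≡.trans (≡.sym (splitAt-↑ˡ ω i k)) (≡.trans (cong (splitAt ω) e) (splitAt-↑ʳ ω k j))
  ... | ()

  inClique-coclique : ∀ j → inClique ω (coclique j) ≡ false
  inClique-coclique j = cong [ (λ _ → true) , (λ _ → false) ]′ (splitAt-↑ʳ ω k j)

  coclique-neighbour : ∀ {j v} → Adj (completeSplit ω k) (coclique j) v → ∃[ i ] v ≡ clique i
  coclique-neighbour {j} {v} e with clique-or-coclique v
  ... | inj₁ found = found
  ... | inj₂ (j′ , refl) = case ≡.trans (≡.sym non-edge) e of λ ()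
    where
    non-edge : splitAdj ω (coclique j) (coclique j′) ≡ false
    non-edge = ≡.cong₂ (λ a b → (a ∨ b) ∧ not (does (coclique j ≟ coclique j′)))
                       (inClique-coclique j) (inClique-coclique j′)

weight : Bool → ℚ
weight true = 1ℚ
weight false = 0ℚ

weight-threshold : ∀ b b′ → does (1ℚ ℚ.≤? weight b +ℚ weight b′) ≡ b ∨ b′
weight-threshold true true = refl
weight-threshold true false = refl
weight-threshold false true = refl
weight-threshold false false = refl

completeSplit-threshold : ∀ ω k → IsThreshold (completeSplit ω k)
completeSplit-threshold ω k = weight ∘ inClique ω , 1ℚ , λ u v u≢v →
  ≡does⇒⇔ (1ℚ ℚ.≤? _) (≡.trans (splitAdj-≢ {ω} {k} u≢v)
                               (≡.sym (weight-threshold (inClique ω u) (inClique ω v))))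

completeSplit-connected : ∀ ω k → Connected (completeSplit (suc ω) k)
completeSplit-connected ω k u v = to-zero u ◅◅ reverseWalk (λ {u} {v} → Adj-sym {G} {u} {v}) (to-zero v)
  where
  G : Graph
  G = completeSplit (suc ω) k
  to-zero : ∀ u → Walk (Adj G) u zero
  to-zero u with u ≟ zero
  ... | yes refl = here
  ... | no u≢0 = step (Adj-sym {G} {zero} {u} (splitAdj-≢ {suc ω} {k} (≢-sym u≢0))) here

-- Two colours do not suffice for K₃ joined to 17 independent vertices

record AtLeast {A : Set} (k : ℕ) (P : Pred A 0ℓ) : Set where
  field
    elements : List A
    enough : k ≤ length elements
    distinct : Unique elements
    satisfy : All P elements

length-filter-split : ∀ {A : Set} {P : Pred A 0ℓ} (P? : Decidable P) xs →
                      length (filter P? xs) + length (filter (λ x → ¬? (P? x)) xs) ≡ length xs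
length-filter-split P? [] = refl
length-filter-split P? (x ∷ xs) with P? x
... | yes _ = cong suc (length-filter-split P? xs)
... | no _ = ≡.trans (ℕ.+-suc _ _) (cong suc (length-filter-split P? xs))

≢0⇒≡1 : ∀ (i : Fin 2) → i ≢ zero → i ≡ suc zero
≢0⇒≡1 zero i≢0 = ⊥-elim (i≢0 refl)
≢0⇒≡1 (suc zero) _ = refl

module _ {A : Set} {P : Pred A 0ℓ} (f : A → Fin 2) where

  private
    is0? : ∀ x → Dec (f x ≡ zero)
    is0? x = f x ≟ zero

    not0? : ∀ x → Dec (f x ≢ zero)
    not0? x = ¬? (f x ≟ zero)

  split₂ : ∀ {k} → AtLeast (suc (k + k)) P → ∃[ b ] AtLeast (suc k) (λ x → P x × f x ≡ b)
  split₂ {k} record { elements = xs ; enough = enough ; distinct = distinct ; satisfy = satisfy }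
    with suc k ℕ.≤? length (filter is0? xs)
  ... | yes many = zero , record
    { elements = filter is0? xs
    ; enough = many
    ; distinct = Unique.filter⁺ is0? distinct
    ; satisfy = All.zip (All.filter⁺ is0? satisfy , all-filter is0? xs)
    }
  ... | no few = suc zero , record
    { elements = filter not0? xs
    ; enough = ℕ.+-cancelˡ-≤ k _ _ (begin
        k + suc k                                          ≡⟨ ℕ.+-suc k k ⟩
        suc (k + k)                                        ≤⟨ enough ⟩
        length xs                                          ≡⟨ ≡.sym (length-filter-split is0? xs) ⟩
        length (filter is0? xs) + length (filter not0? xs) ≤⟨ ℕ.+-monoˡ-≤ _ (ℕ.≤-pred (ℕ.≰⇒> few)) ⟩
        k + length (filter not0? xs)                       ∎)
    ; distinct = Unique.filter⁺ not0? distinct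
    ; satisfy = All.zip (All.filter⁺ not0? satisfy , All.map (≢0⇒≡1 _) (all-filter not0? xs))
    }
    where
    open ℕ.≤-Reasoning

alike-triple : ∀ {A : Set} (profile : A → Fin 3 → Fin 2) → AtLeast 17 (λ _ → ⊤) →
               Σ[ t ∈ (Fin 3 → A) ] Injective _≡_ _≡_ t × (∀ a b i → profile (t a) i ≡ profile (t b) i)
alike-triple {A} profile many with split₂ (λ v → profile v zero) {8} many
... | b₀ , many₀ with split₂ (λ v → profile v (suc zero)) {4} many₀
... | b₁ , many₁ with split₂ (λ v → profile v (suc (suc zero))) {2} many₁
... | b₂ , record { elements = [] ; enough = () }
... | b₂ , record { elements = _ ∷ [] ; enough = s≤s () }
... | b₂ , record { elements = _ ∷ _ ∷ [] ; enough = s≤s (s≤s ()) }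
... | b₂ , record { elements = x ∷ y ∷ z ∷ _
                  ; distinct = (x≢y ∷ x≢z ∷ _) ∷ (y≢z ∷ _) ∷ _
                  ; satisfy = x-ok ∷ y-ok ∷ z-ok ∷ _ } =
  triple x y z , distinct₃⇒injective x≢y x≢z y≢z , alike
  where
  Common : A → Set
  Common v = ((⊤ × profile v zero ≡ b₀) × profile v (suc zero) ≡ b₁) × profile v (suc (suc zero)) ≡ b₂
  common : ∀ {v} → Common v → ∀ i → profile v i ≡ triple b₀ b₁ b₂ i
  common (((_ , e₀) , _) , _) zero = e₀
  common ((_ , e₁) , _) (suc zero) = e₁
  common (_ , e₂) (suc (suc zero)) = e₂
  all-common : ∀ a → Common (triple x y z a)
  all-common zero = x-ok
  all-common (suc zero) = y-ok
  all-common (suc (suc zero)) = z-ok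
  alike : ∀ a b i → profile (triple x y z a) i ≡ profile (triple x y z b) i
  alike a b i = ≡.trans (common (all-common a) i) (≡.sym (common (all-common b) i))

allFin-atLeast : ∀ {k} → m ≤ k → AtLeast m (λ (_ : Fin k) → ⊤)
allFin-atLeast {k = k} m≤k = record
  { elements = allFin k
  ; enough = ≡.subst (_ ≤_) (≡.sym (length-tabulate (λ j → j))) m≤k
  ; distinct = Unique.allFin⁺ k
  ; satisfy = All.universal (λ _ → tt) (allFin k)
  }

module TwoColouredSplit {k : ℕ} (c : EdgeColoring (completeSplit 3 k) 2) where

  profile : Fin k → Fin 3 → Fin 2
  profile j i = col c (coclique j) (clique i)

  module Alike (t : Fin 3 → Fin k) (t-injective : Injective _≡_ _≡_ t)
    (alike : ∀ a b i → profile (t a) i ≡ profile (t b) i) where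

    terminal : Fin 3 → Fin (3 + k)
    terminal a = coclique (t a)

    terminal-apart : ∀ {a b} → a ≢ b → terminal a ≢ terminal b
    terminal-apart a≢b e = a≢b (t-injective (Fin.↑ʳ-injective 3 _ _ e))

    module InTree (H : Subgraph (completeSplit 3 k)) (proper : IsProper c H)
      (connected : ∀ u v → vs H u ≡ true → vs H v ≡ true → Walk (SEdge H) u v)
      (terminal-member : ∀ a → vs H (terminal a) ≡ true) where

      E : Fin (3 + k) → Fin (3 + k) → Set
      E = SEdge H

      E-sym : ∀ {u v} → E u v → E v u
      E-sym {u} {v} e = ≡.trans (es-sym H v u) e

      open MaxDegreeTwo E E-sym (proper₂-max-degree-2 {c = c} {H = H} proper)

      neighbour-in-clique : ∀ {j v} → E (coclique j) v → ∃[ i ] v ≡ clique i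
      neighbour-in-clique {j} {v} e = coclique-neighbour {3} {k} {j} {v} (es-adj H _ _ e)

      no-shared-neighbour : ∀ {a b i} → a ≢ b → E (terminal a) (clique i) → E (terminal b) (clique i) → ⊥
      no-shared-neighbour {a} {b} {i} a≢b ea eb =
        proper-apart {c = c} {H = H} proper (E-sym ea) (E-sym eb) (terminal-apart a≢b) (alike a b i)

      anchor-of : ∀ a → ∃[ i ] E (terminal a) (clique i)
      anchor-of a with first-step (connected _ _ (terminal-member a) (terminal-member (punchIn a zero)))
                                  (terminal-apart (≢-sym (Fin.punchInᵢ≢i a zero)))
      ... | q , e with neighbour-in-clique e
      ... | i , refl = i , e

      anchor : Fin 3 → Fin 3
      anchor a = proj₁ (anchor-of a)

      anchor-edge : ∀ a → E (terminal a) (clique (anchor a))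
      anchor-edge a = proj₂ (anchor-of a)

      anchor-injective : Injective _≡_ _≡_ anchor
      anchor-injective {a} {b} same with a ≟ b
      ... | yes a≡b = a≡b
      ... | no a≢b = ⊥-elim (no-shared-neighbour a≢b (anchor-edge a)
                               (≡.subst (E (terminal b) ∘ clique) (≡.sym same) (anchor-edge b)))

      only-anchor : ∀ a {q} → E (terminal a) q → q ≡ clique (anchor a)
      only-anchor a e with neighbour-in-clique e
      ... | i , refl with injective⇒surjective anchor-injective i
      ... | b , refl with a ≟ b
      ... | yes refl = refl
      ... | no a≢b = ⊥-elim (no-shared-neighbour a≢b e (anchor-edge b))

      terminal-leaf : ∀ a → Leaf (terminal a)
      terminal-leaf a e e′ = ≡.trans (only-anchor a e) (≡.sym (only-anchor a e′))

      another-neighbour? : ∀ u p → (∃[ s ] E u s × s ≢ p) ⊎ (∀ {w} → E u w → w ≡ p)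
      another-neighbour? u p with any? (λ s → (es H u s Bool.≟ true) ×-dec ¬? (s ≟ p))
      ... | yes found = inj₁ found
      ... | no none = inj₂ only-p
        where
        only-p : ∀ {w} → E u w → w ≡ p
        only-p {w} e with w ≟ p
        ... | yes w≡p = w≡p
        ... | no w≢p = ⊥-elim (none (w , e , w≢p))

      to-terminal : ∀ {p} b → p ≢ terminal b → PathToLeaf p (clique (anchor b))
      to-terminal b p≢b = next (E-sym (anchor-edge b)) (≢-sym p≢b) (end (only-anchor b))

      x px : Fin (3 + k)
      x = terminal zero
      px = clique (anchor zero)

      -- Follow H from the leaf x: within two more steps it reaches a clique vertex, and the
      -- terminal anchored there ends the path.
      path-from-x : PathToLeaf x px
      path-from-x with another-neighbour? px x
      ... | inj₂ only-x = end only-x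
      ... | inj₁ (s , px~s , s≢x) with clique-or-coclique {3} {k} s
      ...   | inj₁ (j , refl) with injective⇒surjective anchor-injective j
      ...     | b , refl = next px~s s≢x (to-terminal b clique≢coclique)
      path-from-x | inj₁ (s , px~s , s≢x) | inj₂ (_ , refl) with another-neighbour? s px
      ...   | inj₂ only-px = next px~s s≢x (end only-px)
      ...   | inj₁ (r , s~r , r≢px) with neighbour-in-clique s~r
      ...     | j , refl with injective⇒surjective anchor-injective j
      ...       | b , refl = next px~s s≢x (next s~r r≢px (to-terminal b s≢b))
        where
        s≢b : s ≢ terminal b
        s≢b s≡b = r≢px (≡.sym (only-anchor b (≡.subst (λ u → E u px) s≡b (E-sym px~s))))

      contradiction : ⊥
      contradiction = terminal-apart {suc zero} {suc (suc zero)} (λ ())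
        (at-most-two-leaves (anchor-edge zero) (terminal-leaf zero) path-from-x
          (connected _ _ (terminal-member zero) (terminal-member (suc zero)))
          (connected _ _ (terminal-member zero) (terminal-member (suc (suc zero))))
          (terminal-leaf (suc zero)) (terminal-leaf (suc (suc zero)))
          (terminal-apart (λ ())) (terminal-apart (λ ())))

    not-3-proper : ¬ Is3Proper c
    not-3-proper three-proper
      with H , (connected , _) , m₀ , m₁ , m₂ , proper ←
           three-proper (terminal zero) (terminal (suc zero)) (terminal (suc (suc zero)))
                        (terminal-apart (λ ())) (terminal-apart (λ ())) (terminal-apart (λ ()))
      = InTree.contradiction H proper connected member
      where
      member : ∀ a → vs H (terminal a) ≡ true
      member zero = m₀
      member (suc zero) = m₁
      member (suc (suc zero)) = m₂

completeSplit-px3>2 : ∀ {k} → 17 ≤ k → ¬ px3≤ (completeSplit 3 k) 2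
completeSplit-px3>2 17≤k (c , three-proper) =
  let t , t-injective , alike = alike-triple profile (allFin-atLeast 17≤k)
  in Alike.not-3-proper t t-injective alike three-proper
  where open TwoColouredSplit c

K₃∨E₁₇ : Graph
K₃∨E₁₇ = completeSplit 3 17

K₃∨E₁₇-min-degree : MinDegreeAtLeast 3 K₃∨E₁₇
K₃∨E₁₇-min-degree = toWitness {a? = Fin.all? (λ v → 3 ℕ.≤? degree K₃∨E₁₇ v)} tt

corollary3p5 : ((G : Graph) → Connected G → IsThreshold G → MinDegreeAtLeast 3 G → px3≤ G 3)
    × Σ Graph (λ G → Connected G × IsThreshold G × MinDegreeAtLeast 3 G × px3≡ G 3)
corollary3p5 =
  (λ G _ → threshold-px3≤3 G) ,
  K₃∨E₁₇ , completeSplit-connected 2 17 , completeSplit-threshold 3 17 , K₃∨E₁₇-min-degree ,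
  threshold-px3≤3 K₃∨E₁₇ (completeSplit-threshold 3 17) K₃∨E₁₇-min-degree ,
  completeSplit-px3>2 ℕ.≤-refl
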